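{- Let $v=(a,b,c,d)\in\mathbb Z^4$ be a primitive integer Descartes quadruple with $a+b+c+d>0$. Then iteration of $T_I$ on $v$ reaches, after finitely many steps $n$, one of the simplest Descartes quadruples $(1,1,0,0),(1,0,1,0),(1,0,0,1),(0,1,1,0),(0,1,0,1),(0,0,1,1)$; the word $W_1W_2\cdots W_n$ produced is in invert normal form, and $v^t=W_1W_2\cdots W_n\,\sigma(1,1,0,0)^t$ for some permutation $\sigma$ of the coordinates.
   Context: A Descartes quadruple is a vector $y=(y_0,y_1,y_2,y_3)$ with $(y_0+y_1+y_2+y_3)^2-2(y_0^2+y_1^2+y_2^2+y_3^2)=0$; primitive integer means $y\in\mathbb Z^4$ with $\gcd=1$. Matrices: $S_1=\begin{pmatrix}-1&2&2&2\\0&1&0&0\\0&0&1&0\\0&0&0&1\end{pmatrix}$, $S_2=\begin{pmatrix}1&0&0&0\\2&-1&2&2\\0&0&1&0\\0&0&0&1\end{pmatrix}$, $S_3=\begin{pmatrix}1&0&0&0\\0&1&0&0\\2&2&-1&2\\0&0&0&1\end{pmatrix}$, $S_4=\begin{pmatrix}1&0&0&0\\0&1&0&0\\0&0&1&0\\2&2&2&-1\end{pmatrix}$, $S_1^\perp=\begin{pmatrix}-1&0&0&0\\2&1&0&0\\2&0&1&0\\2&0&0&1\end{pmatrix}$, $S_2^\perp=\begin{pmatrix}1&2&0&0\\0&-1&0&0\\0&2&1&0\\0&2&0&1\end{pmatrix}$, $S_3^\perp=\begin{pmatrix}1&0&2&0\\0&1&2&0\\0&0&-1&0\\0&0&2&1\end{pmatrix}$,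 $S_4^\perp=\begin{pmatrix}1&0&0&2\\0&1&0&2\\0&0&1&2\\0&0&0&-1\end{pmatrix}$. $T_I(a,b,c,d)=M(a,b,c,d)^t$ where $M$ is the first matrix in this list whose condition holds: $S_1$ if $b+c+d<a$; $S_2$ if $a+c+d<b$; $S_3$ if $a+b+d<c$; $S_4$ if $a+b+c<d$; $S_1^\perp$ if $a<0$; $S_2^\perp$ if $b<0$; $S_3^\perp$ if $c<0$; $S_4^\perp$ if $d<0$. The word is defined by $T_I^k(v)^t=W_kT_I^{k-1}(v)^t$ for $k=1,\dots,n$, $n$ being the first index at which a simplest Descartes quadruple is reached. A word $W_1W_2\cdots W_n$ (read left to right) is in invert normal form if $W_k\ne W_{k+1}$ for all $k$ and there is no $k$ with $W_k=S_j^\perp$, $W_{k+1}=S_i$, $i\ne j$. -}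

module Defs where

open import Data.Nat as ℕ using (ℕ)
open import Data.Integer using (ℤ; +_; -_; _+_; _*_; _<_; _<?_; _-_)
open import Data.Integer.GCD using (gcd)
open import Data.Fin using (Fin; zero; suc)
open import Data.Vec using (Vec; []; _∷_; map; lookup; tabulate; foldr)
open import Data.List using (List; []; _∷_)
open import Data.List.Membership.Propositional using (_∈_)
open import Data.List.Relation.Unary.Linked using (Linked)
open import Data.Maybe using (Maybe; just; nothing)
open import Data.Bool using (if_then_else_)
open import Data.Product using (_×_; Σ; ∃; _,_)
open import Relation.Nullary using (¬_; does)
open import Relation.Binary.PropositionalEquality using (_≡_; _≢_)
open import Data.Fin.Permutation using (Permutation′; _⟨$⟩ʳ_)

-- Quadruples (column vectors) and 4×4 integer matrices (list of rows).
Quad : Set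
Quad = Vec ℤ 4

Mat : Set
Mat = Vec (Vec ℤ 4) 4

dot : Vec ℤ 4 → Vec ℤ 4 → ℤ
dot (x0 ∷ x1 ∷ x2 ∷ x3 ∷ []) (y0 ∷ y1 ∷ y2 ∷ y3 ∷ []) =
  x0 * y0 + x1 * y1 + x2 * y2 + x3 * y3

_·_ : Mat → Quad → Quad
M · v = map (λ row → dot row v) M

sum4 : Quad → ℤ
sum4 (a ∷ b ∷ c ∷ d ∷ []) = a + b + c + d

sqsum4 : Quad → ℤ
sqsum4 (a ∷ b ∷ c ∷ d ∷ []) = a * a + b * b + c * c + d * d

IsDescartes : Quad → Set
IsDescartes y = sum4 y * sum4 y - + 2 * sqsum4 y ≡ + 0

gcd4 : Quad → ℤ
gcd4 (a ∷ b ∷ c ∷ d ∷ []) = gcd a (gcd b (gcd c d))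

IsPrimitive : Quad → Set
IsPrimitive y = gcd4 y ≡ + 1

-- the eight generators: S i and S⊥ i  (i = 0..3 stands for index 1..4)
data Gen : Set where
  S  : Fin 4 → Gen
  S⊥ : Fin 4 → Gen

m1 : ℤ
m1 = - + 1

mat : Gen → Mat
mat (S zero) =
  (m1 ∷ + 2 ∷ + 2 ∷ + 2 ∷ []) ∷ (+ 0 ∷ + 1 ∷ + 0 ∷ + 0 ∷ []) ∷
  (+ 0 ∷ + 0 ∷ + 1 ∷ + 0 ∷ []) ∷ (+ 0 ∷ + 0 ∷ + 0 ∷ + 1 ∷ []) ∷ []
mat (S (suc zero)) =
  (+ 1 ∷ + 0 ∷ + 0 ∷ + 0 ∷ []) ∷ (+ 2 ∷ m1 ∷ + 2 ∷ + 2 ∷ []) ∷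
  (+ 0 ∷ + 0 ∷ + 1 ∷ + 0 ∷ []) ∷ (+ 0 ∷ + 0 ∷ + 0 ∷ + 1 ∷ []) ∷ []
mat (S (suc (suc zero))) =
  (+ 1 ∷ + 0 ∷ + 0 ∷ + 0 ∷ []) ∷ (+ 0 ∷ + 1 ∷ + 0 ∷ + 0 ∷ []) ∷
  (+ 2 ∷ + 2 ∷ m1 ∷ + 2 ∷ []) ∷ (+ 0 ∷ + 0 ∷ + 0 ∷ + 1 ∷ []) ∷ []
mat (S (suc (suc (suc zero)))) =
  (+ 1 ∷ + 0 ∷ + 0 ∷ + 0 ∷ []) ∷ (+ 0 ∷ + 1 ∷ + 0 ∷ + 0 ∷ []) ∷
  (+ 0 ∷ + 0 ∷ + 1 ∷ + 0 ∷ []) ∷ (+ 2 ∷ + 2 ∷ + 2 ∷ m1 ∷ []) ∷ []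
mat (S⊥ zero) =
  (m1 ∷ + 0 ∷ + 0 ∷ + 0 ∷ []) ∷ (+ 2 ∷ + 1 ∷ + 0 ∷ + 0 ∷ []) ∷
  (+ 2 ∷ + 0 ∷ + 1 ∷ + 0 ∷ []) ∷ (+ 2 ∷ + 0 ∷ + 0 ∷ + 1 ∷ []) ∷ []
mat (S⊥ (suc zero)) =
  (+ 1 ∷ + 2 ∷ + 0 ∷ + 0 ∷ []) ∷ (+ 0 ∷ m1 ∷ + 0 ∷ + 0 ∷ []) ∷
  (+ 0 ∷ + 2 ∷ + 1 ∷ + 0 ∷ []) ∷ (+ 0 ∷ + 2 ∷ + 0 ∷ + 1 ∷ []) ∷ []
mat (S⊥ (suc (suc zero))) =
  (+ 1 ∷ + 0 ∷ + 2 ∷ + 0 ∷ []) ∷ (+ 0 ∷ + 1 ∷ + 2 ∷ + 0 ∷ []) ∷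
  (+ 0 ∷ + 0 ∷ m1 ∷ + 0 ∷ []) ∷ (+ 0 ∷ + 0 ∷ + 2 ∷ + 1 ∷ []) ∷ []
mat (S⊥ (suc (suc (suc zero)))) =
  (+ 1 ∷ + 0 ∷ + 0 ∷ + 2 ∷ []) ∷ (+ 0 ∷ + 1 ∷ + 0 ∷ + 2 ∷ []) ∷
  (+ 0 ∷ + 0 ∷ + 1 ∷ + 2 ∷ []) ∷ (+ 0 ∷ + 0 ∷ + 0 ∷ m1 ∷ []) ∷ []

chooseGen : Quad → Maybe Gen
chooseGen (a ∷ b ∷ c ∷ d ∷ []) =
  if does (b + c + d <? a) then just (S zero) else
  if does (a + c + d <? b) then just (S (suc zero)) else
  if does (a + b + d <? c) then just (S (suc (suc zero))) else
  if does (a + b + c <? d) then just (S (suc (suc (suc zero)))) else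
  if does (a <? + 0) then just (S⊥ zero) else
  if does (b <? + 0) then just (S⊥ (suc zero)) else
  if does (c <? + 0) then just (S⊥ (suc (suc zero))) else
  if does (d <? + 0) then just (S⊥ (suc (suc (suc zero)))) else
  nothing

q : ℤ → ℤ → ℤ → ℤ → Quad
q a b c d = a ∷ b ∷ c ∷ d ∷ []

simplestList : List Quad
simplestList =
  q (+ 1) (+ 1) (+ 0) (+ 0) ∷ q (+ 1) (+ 0) (+ 1) (+ 0) ∷ q (+ 1) (+ 0) (+ 0) (+ 1) ∷
  q (+ 0) (+ 1) (+ 1) (+ 0) ∷ q (+ 0) (+ 1) (+ 0) (+ 1) ∷ q (+ 0) (+ 0) (+ 1) (+ 1) ∷ []

Simplest : Quad → Set
Simplest v = v ∈ simplestList

-- TIRun v ws w : iterating T_I from v, the word produced is ws (W_1 ... W_n,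
-- with W_k the matrix used at step k) and the first simplest quadruple
-- reached is w = T_I^n(v), where n = length ws.
data TIRun : Quad → List Gen → Quad → Set where
  stop : ∀ {v} → Simplest v → TIRun v [] v
  step : ∀ {v g ws w} → ¬ Simplest v → chooseGen v ≡ just g →
         TIRun (mat g · v) ws w → TIRun v (g ∷ ws) w

data BadPair : Gen → Gen → Set where
  sameMat : ∀ {g h} → mat g ≡ mat h → BadPair g h
  perpThenS : ∀ {i j} → i ≢ j → BadPair (S⊥ j) (S i)

InvertNormalForm : List Gen → Set
InvertNormalForm = Linked (λ g h → ¬ BadPair g h)

applyWord : List Gen → Quad → Quad
applyWord [] x = x
applyWord (g ∷ ws) x = mat g · applyWord ws x

base : Quad
base = q (+ 1) (+ 1) (+ 0) (+ 0)

permute : Permutation′ 4 → Quad → Quad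
permute σ x = tabulate (λ i → lookup x (σ ⟨$⟩ʳ i))

{-# OPTIONS --safe #-}
module Submission where

-- T_I is a descent on the curvature sum s = a + b + c + d. Every generator is an
-- integral involution preserving the Descartes form, so the form and the gcd of the
-- entries are invariant. If T_I picks S i (entry x exceeds the sum t of the others) or
-- S⊥ j (entry x is negative), s becomes 3t − x or 5x + t, which is smaller; it stays
-- positive because 4 s s′ − s² − s′² = 2 (t² + 6xt − 3x²), and the Descartes equation
-- makes t² + 6xt − 3x² a sum of squares. When T_I picks nothing, all entries are
-- nonnegative and none exceeds the others, yet Σ xᵢ (tᵢ − xᵢ) is the Descartes form,
-- so every entry is 0 or s / 2; primitivity then leaves a simplest quadruple.
-- The word is in invert normal form: a repeated matrix would undo the previous step
-- although s decreased twice, and S⊥ j leaves the excess xᵢ − tᵢ (i ≠ j) unchanged,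
-- so S i cannot follow it.

open import Defs
open import Data.Integer using (ℤ; +_; _<_)
open import Data.List using (List)
open import Data.Product using (Σ; _×_)
open import Data.Fin.Permutation using (Permutation′)
open import Relation.Binary.PropositionalEquality using (_≡_)

open import Data.Empty using (⊥; ⊥-elim)
open import Data.Fin using (Fin)
open import Data.Fin.Patterns using (0F; 1F; 2F; 3F)
open import Data.Fin.Permutation using (_∘ₚ_) renaming (id to idₚ; transpose to swap)
open import Data.Integer using (-[1+_]; _+_; _*_; -_; _-_; _≤_; _<?_; _≟_; +≤+; +<+; ∣_∣)
open import Data.Integer.Divisibility using () renaming (_∣_ to _∣ᵤ_)
open import Data.Integer.Divisibility.Signed
  using (_∣_; divides; ∣-refl; ∣m∣n⇒∣m+n; ∣n⇒∣m*n; ∣⇒∣ᵤ; ∣ᵤ⇒∣)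
open import Data.Integer.GCD using (gcd; gcd-greatest)
open import Data.Integer.Properties
  using ( <⇒≤; ≮⇒≥; <-irrefl; +-mono-≤; +-monoʳ-≤; +-monoˡ-<; +-identityˡ
        ; +-identityʳ; +-inverseʳ; *-zeroʳ; pos-*; i-j≡0⇒i≡j; i≤j⇒0≤j-i; 0≤i-j⇒j≤i
        ; i*j≡0⇒i≡0∨j≡0; *-cancelˡ-<-nonNeg; *-cancelˡ-≡; module ≤-Reasoning )
open import Data.Integer.Tactic.RingSolver using (solve-∀)
open import Data.List using ([]; _∷_)
open import Data.List.Relation.Unary.Any using (here; there)
open import Data.List.Relation.Unary.Linked using ([]; [-]; _∷_)
open import Data.Maybe using (Maybe; just; nothing)
open import Data.Nat as ℕ using (ℕ; z≤n; s≤s)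
open import Data.Nat.Divisibility using (∣1⇒≡1)
open import Data.Nat.Induction using (<-wellFounded)
open import Data.Nat.Properties using (m+n≡0⇒m≡0; m+n≡0⇒n≡0)
open import Data.Product using (_,_; proj₁; proj₂; ∃)
open import Data.Sum using (_⊎_; inj₁; inj₂; map₂)
open import Data.Vec using (_∷_; []; lookup; map; transpose)
open import Data.Vec.Properties using (≡-dec; map-cong; map-∘)
open import Data.List.Membership.DecPropositional (≡-dec {n = 4} _≟_) using (_∈?_)
open import Function using (_∘_)
open import Induction.WellFounded using (Acc; acc)
open import Relation.Binary.PropositionalEquality
  using (_≢_; refl; sym; trans; cong; cong₂; subst; subst₂; module ≡-Reasoning)
open import Relation.Nullary using (¬_; yes; no)

*-nonneg : ∀ {x y} → + 0 ≤ x → + 0 ≤ y → + 0 ≤ x * y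
*-nonneg {+ m} {+ n} _ _ = subst (+ 0 ≤_) (pos-* m n) (+≤+ z≤n)

square-nonneg : ∀ x → + 0 ≤ x * x
square-nonneg (+ n)    = *-nonneg {+ n} {+ n} (+≤+ z≤n) (+≤+ z≤n)
square-nonneg -[1+ n ] = +≤+ z≤n

nonneg-+-zero : ∀ {x y} → + 0 ≤ x → + 0 ≤ y → x + y ≡ + 0 → x ≡ + 0 × y ≡ + 0
nonneg-+-zero {+ m} {+ n} _ _ eq =
  cong +_ (m+n≡0⇒m≡0 m (cong ∣_∣ eq)) , cong +_ (m+n≡0⇒n≡0 m (cong ∣_∣ eq))

nonneg-sum4-zero : (t : Fin 4 → ℤ) → (∀ i → + 0 ≤ t i) →
                   t 0F + t 1F + t 2F + t 3F ≡ + 0 → ∀ i → t i ≡ + 0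
nonneg-sum4-zero t nonneg total = λ where
    0F → proj₁ zero₀₁
    1F → proj₂ zero₀₁
    2F → proj₂ zero₀₁₂
    3F → proj₂ zero₀₁₂₃
  where
  zero₀₁₂₃ : t 0F + t 1F + t 2F ≡ + 0 × t 3F ≡ + 0
  zero₀₁₂₃ = nonneg-+-zero (+-mono-≤ (+-mono-≤ (nonneg 0F) (nonneg 1F)) (nonneg 2F)) (nonneg 3F) total
  zero₀₁₂ : t 0F + t 1F ≡ + 0 × t 2F ≡ + 0
  zero₀₁₂ = nonneg-+-zero (+-mono-≤ (nonneg 0F) (nonneg 1F)) (nonneg 2F) (proj₁ zero₀₁₂₃)
  zero₀₁ : t 0F ≡ + 0 × t 1F ≡ + 0
  zero₀₁ = nonneg-+-zero (nonneg 0F) (nonneg 1F) (proj₁ zero₀₁₂)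

<⇒0<-difference : ∀ {x y} → x < y → + 0 < y - x
<⇒0<-difference {x} {y} x<y = subst (_< y - x) (+-inverseʳ x) (+-monoˡ-< (- x) x<y)

0<-difference⇒< : ∀ {x y} → + 0 < y - x → x < y
0<-difference⇒< {x} {y} 0<y-x =
  subst₂ _<_ (+-identityˡ x) (cancel y x) (+-monoˡ-< x 0<y-x)
  where
  cancel : ∀ y x → y - x + x ≡ y
  cancel = solve-∀

<-by-gap : ∀ {x y x′ y′} k → x′ < y′ → y - x ≡ + ℕ.suc k * (y′ - x′) → x < y
<-by-gap k x′<y′ gap = 0<-difference⇒< (subst (+ 0 <_) (sym gap) (multiple (<⇒0<-difference x′<y′)))
  where
  multiple : ∀ {z} → + 0 < z → + 0 < + ℕ.suc k * z
  multiple {+ 0}       (+<+ ())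
  multiple {+ ℕ.suc _} _ = +<+ (s≤s z≤n)

≤-by-gap : ∀ {x y g} → + 0 ≤ g → y - x ≡ g → x ≤ y
≤-by-gap 0≤g gap = 0≤i-j⇒j≤i (subst (+ 0 ≤_) (sym gap) 0≤g)

positive-of-bound : ∀ {s s′} → + 0 < s → s * s + s′ * s′ ≤ + 4 * (s * s′) → + 0 < s′
positive-of-bound {+ 0}                 (+<+ ()) _
positive-of-bound {s@(+ ℕ.suc _)} {s′} _        bound =
  *-cancelˡ-<-nonNeg s (subst (_< s * s′) (sym (*-zeroʳ s)) (*-cancelˡ-<-nonNeg (+ 4) (begin-strict
    + 0              <⟨ +<+ (s≤s z≤n) ⟩
    s * s            ≡⟨ +-identityʳ (s * s) ⟨
    s * s + + 0      ≤⟨ +-monoʳ-≤ (s * s) (square-nonneg s′) ⟩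
    s * s + s′ * s′  ≤⟨ bound ⟩
    + 4 * (s * s′)   ∎)))
  where open ≤-Reasoning

double-injective : ∀ {x y} → x + x ≡ y + y → x ≡ y
double-injective {x} {y} eq = *-cancelˡ-≡ (+ 2) x y (begin
  + 2 * x  ≡⟨ double x ⟩
  x + x    ≡⟨ eq ⟩
  y + y    ≡⟨ double y ⟨
  + 2 * y  ∎)
  where
  open ≡-Reasoning
  double : ∀ z → + 2 * z ≡ z + z
  double = solve-∀

unit-of-positive-double : ∀ {h} → h ∣ + 1 → + 0 < h + h → h ≡ + 1
unit-of-positive-double {+ _} h∣1 _ with ∣1⇒≡1 (∣⇒∣ᵤ h∣1)
... | refl = refl
unit-of-positive-double { -[1+ _ ]} h∣1 pos with ∣1⇒≡1 (∣⇒∣ᵤ h∣1) | pos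
... | refl | ()

∣∣-mono-< : ∀ {i j} → + 0 ≤ i → i < j → ∣ i ∣ ℕ.< ∣ j ∣
∣∣-mono-< (+≤+ _) (+<+ i<j) = i<j

ones : Quad
ones = + 1 ∷ + 1 ∷ + 1 ∷ + 1 ∷ []

identity : Mat
identity = (+ 1 ∷ + 0 ∷ + 0 ∷ + 0 ∷ []) ∷ (+ 0 ∷ + 1 ∷ + 0 ∷ + 0 ∷ []) ∷
           (+ 0 ∷ + 0 ∷ + 1 ∷ + 0 ∷ []) ∷ (+ 0 ∷ + 0 ∷ + 0 ∷ + 1 ∷ []) ∷ []

_⊗_ : Mat → Mat → Mat
M ⊗ N = map (transpose N ·_) M

·-identity : ∀ v → identity · v ≡ v
·-identity (a ∷ b ∷ c ∷ d ∷ []) =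
  cong₂ _∷_ (row₀ a b c d) (cong₂ _∷_ (row₁ a b c d) (cong₂ _∷_ (row₂ a b c d) (cong₂ _∷_ (row₃ a b c d) refl)))
  where
  row₀ : ∀ a b c d → + 1 * a + + 0 * b + + 0 * c + + 0 * d ≡ a
  row₀ = solve-∀
  row₁ : ∀ a b c d → + 0 * a + + 1 * b + + 0 * c + + 0 * d ≡ b
  row₁ = solve-∀
  row₂ : ∀ a b c d → + 0 * a + + 0 * b + + 1 * c + + 0 * d ≡ c
  row₂ = solve-∀
  row₃ : ∀ a b c d → + 0 * a + + 0 * b + + 0 * c + + 1 * d ≡ d
  row₃ = solve-∀

dot-· : ∀ r M v → dot r (M · v) ≡ dot (transpose M · r) v
dot-· (r₀ ∷ r₁ ∷ r₂ ∷ r₃ ∷ [])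
      ((m₀₀ ∷ m₀₁ ∷ m₀₂ ∷ m₀₃ ∷ []) ∷ (m₁₀ ∷ m₁₁ ∷ m₁₂ ∷ m₁₃ ∷ []) ∷
       (m₂₀ ∷ m₂₁ ∷ m₂₂ ∷ m₂₃ ∷ []) ∷ (m₃₀ ∷ m₃₁ ∷ m₃₂ ∷ m₃₃ ∷ []) ∷ [])
      (a ∷ b ∷ c ∷ d ∷ []) =
  bilinear r₀ r₁ r₂ r₃ m₀₀ m₀₁ m₀₂ m₀₃ m₁₀ m₁₁ m₁₂ m₁₃ m₂₀ m₂₁ m₂₂ m₂₃ m₃₀ m₃₁ m₃₂ m₃₃ a b c d
  where
  bilinear : ∀ r₀ r₁ r₂ r₃ m₀₀ m₀₁ m₀₂ m₀₃ m₁₀ m₁₁ m₁₂ m₁₃ m₂₀ m₂₁ m₂₂ m₂₃ m₃₀ m₃₁ m₃₂ m₃₃ a b c d →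
    r₀ * (m₀₀ * a + m₀₁ * b + m₀₂ * c + m₀₃ * d) + r₁ * (m₁₀ * a + m₁₁ * b + m₁₂ * c + m₁₃ * d) +
    r₂ * (m₂₀ * a + m₂₁ * b + m₂₂ * c + m₂₃ * d) + r₃ * (m₃₀ * a + m₃₁ * b + m₃₂ * c + m₃₃ * d)
    ≡ (m₀₀ * r₀ + m₁₀ * r₁ + m₂₀ * r₂ + m₃₀ * r₃) * a + (m₀₁ * r₀ + m₁₁ * r₁ + m₂₁ * r₂ + m₃₁ * r₃) * b +
      (m₀₂ * r₀ + m₁₂ * r₁ + m₂₂ * r₂ + m₃₂ * r₃) * c + (m₀₃ * r₀ + m₁₃ * r₁ + m₂₃ * r₂ + m₃₃ * r₃) * d
  bilinear = solve-∀

·-⊗ : ∀ M N v → M · (N · v) ≡ (M ⊗ N) · v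
·-⊗ M N v = begin
  M · (N · v)                              ≡⟨ map-cong (λ r → dot-· r N v) M ⟩
  map (λ r → dot (transpose N · r) v) M    ≡⟨ map-∘ (λ r → dot r v) (transpose N ·_) M ⟩
  (M ⊗ N) · v                              ∎
  where open ≡-Reasoning

sum4-· : ∀ M v → sum4 (M · v) ≡ dot (transpose M · ones) v
sum4-· M v = trans (sum4≡dot-ones (M · v)) (dot-· ones M v)
  where
  ones-dot : ∀ a b c d → a + b + c + d ≡ + 1 * a + + 1 * b + + 1 * c + + 1 * d
  ones-dot = solve-∀
  sum4≡dot-ones : ∀ u → sum4 u ≡ dot ones u
  sum4≡dot-ones (a ∷ b ∷ c ∷ d ∷ []) = ones-dot a b c d

·-involutive : ∀ g v → mat g · (mat g · v) ≡ v
·-involutive g v = begin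
  mat g · (mat g · v)   ≡⟨ ·-⊗ (mat g) (mat g) v ⟩
  (mat g ⊗ mat g) · v   ≡⟨ cong (_· v) (squared g) ⟩
  identity · v          ≡⟨ ·-identity v ⟩
  v                     ∎
  where
  open ≡-Reasoning
  squared : ∀ g → mat g ⊗ mat g ≡ identity
  squared (S 0F)  = refl
  squared (S 1F)  = refl
  squared (S 2F)  = refl
  squared (S 3F)  = refl
  squared (S⊥ 0F) = refl
  squared (S⊥ 1F) = refl
  squared (S⊥ 2F) = refl
  squared (S⊥ 3F) = refl

descartesMatrix : Mat
descartesMatrix = (- + 1 ∷ + 1 ∷ + 1 ∷ + 1 ∷ []) ∷ (+ 1 ∷ - + 1 ∷ + 1 ∷ + 1 ∷ []) ∷
                  (+ 1 ∷ + 1 ∷ - + 1 ∷ + 1 ∷ []) ∷ (+ 1 ∷ + 1 ∷ + 1 ∷ - + 1 ∷ []) ∷ []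

descartesForm : Quad → ℤ
descartesForm v = sum4 v * sum4 v - + 2 * sqsum4 v

descartesForm-quadratic : ∀ v → descartesForm v ≡ dot (descartesMatrix · v) v
descartesForm-quadratic (a ∷ b ∷ c ∷ d ∷ []) = quadratic a b c d
  where
  quadratic : ∀ a b c d →
    (a + b + c + d) * (a + b + c + d) - + 2 * (a * a + b * b + c * c + d * d) ≡
    (- + 1 * a + + 1 * b + + 1 * c + + 1 * d) * a + (+ 1 * a + - + 1 * b + + 1 * c + + 1 * d) * b +
    (+ 1 * a + + 1 * b + - + 1 * c + + 1 * d) * c + (+ 1 * a + + 1 * b + + 1 * c + - + 1 * d) * d
  quadratic = solve-∀

descartesForm-invariant : ∀ g v → descartesForm (mat g · v) ≡ descartesForm v
descartesForm-invariant g v = begin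
  descartesForm (M · v)                       ≡⟨ descartesForm-quadratic (M · v) ⟩
  dot (Q · (M · v)) (M · v)                   ≡⟨ cong (λ u → dot u (M · v)) (·-⊗ Q M v) ⟩
  dot ((Q ⊗ M) · v) (M · v)                   ≡⟨ dot-· ((Q ⊗ M) · v) M v ⟩
  dot (transpose M · ((Q ⊗ M) · v)) v         ≡⟨ cong (λ u → dot u v) (·-⊗ (transpose M) (Q ⊗ M) v) ⟩
  dot ((transpose M ⊗ (Q ⊗ M)) · v) v         ≡⟨ cong (λ N → dot (N · v) v) (isometry g) ⟩
  dot (Q · v) v                               ≡⟨ descartesForm-quadratic v ⟨
  descartesForm v                             ∎
  where
  open ≡-Reasoning
  M Q : Mat
  M = mat g
  Q = descartesMatrix
  isometry : ∀ g → transpose (mat g) ⊗ (descartesMatrix ⊗ mat g) ≡ descartesMatrix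
  isometry (S 0F)  = refl
  isometry (S 1F)  = refl
  isometry (S 2F)  = refl
  isometry (S 3F)  = refl
  isometry (S⊥ 0F) = refl
  isometry (S⊥ 1F) = refl
  isometry (S⊥ 2F) = refl
  isometry (S⊥ 3F) = refl

isDescartes-mat : ∀ g {v} → IsDescartes v → IsDescartes (mat g · v)
isDescartes-mat g {v} D = trans (descartesForm-invariant g v) D

CommonDivisor : ℤ → Quad → Set
CommonDivisor k v = ∀ i → k ∣ lookup v i

EntriesCoprime : Quad → Set
EntriesCoprime v = ∀ k → CommonDivisor k v → k ∣ + 1

∣-dot : ∀ {k} r v → CommonDivisor k v → k ∣ dot r v
∣-dot (r₀ ∷ r₁ ∷ r₂ ∷ r₃ ∷ []) (a ∷ b ∷ c ∷ d ∷ []) k∣v =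
  ∣m∣n⇒∣m+n (∣m∣n⇒∣m+n (∣m∣n⇒∣m+n (∣n⇒∣m*n r₀ (k∣v 0F)) (∣n⇒∣m*n r₁ (k∣v 1F)))
                                  (∣n⇒∣m*n r₂ (k∣v 2F)))
            (∣n⇒∣m*n r₃ (k∣v 3F))

commonDivisor-· : ∀ {k} M v → CommonDivisor k v → CommonDivisor k (M · v)
commonDivisor-· (r₀ ∷ r₁ ∷ r₂ ∷ r₃ ∷ []) v k∣v = λ where
  0F → ∣-dot r₀ v k∣v
  1F → ∣-dot r₁ v k∣v
  2F → ∣-dot r₂ v k∣v
  3F → ∣-dot r₃ v k∣v

entriesCoprime-mat : ∀ g {v} → EntriesCoprime v → EntriesCoprime (mat g · v)
entriesCoprime-mat g {v} coprime k k∣gv =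
  coprime k (subst (CommonDivisor k) (·-involutive g v) (commonDivisor-· (mat g) (mat g · v) k∣gv))

isPrimitive⇒entriesCoprime : ∀ {v} → IsPrimitive v → EntriesCoprime v
isPrimitive⇒entriesCoprime {a ∷ b ∷ c ∷ d ∷ []} gcd≡1 k k∣v =
  ∣ᵤ⇒∣ (subst (k ∣ᵤ_) gcd≡1
    (gcd-greatest {a} {gcd b (gcd c d)} {k} (∣⇒∣ᵤ (k∣v 0F))
      (gcd-greatest {b} {gcd c d} {k} (∣⇒∣ᵤ (k∣v 1F))
        (gcd-greatest {c} {d} {k} (∣⇒∣ᵤ (k∣v 2F)) (∣⇒∣ᵤ (k∣v 3F))))))

othersSum : Fin 4 → Quad → ℤ
othersSum 0F (a ∷ b ∷ c ∷ d ∷ []) = b + c + d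
othersSum 1F (a ∷ b ∷ c ∷ d ∷ []) = a + c + d
othersSum 2F (a ∷ b ∷ c ∷ d ∷ []) = a + b + d
othersSum 3F (a ∷ b ∷ c ∷ d ∷ []) = a + b + c

sum4-split : ∀ i v → sum4 v ≡ lookup v i + othersSum i v
sum4-split 0F (a ∷ b ∷ c ∷ d ∷ []) = split₀ a b c d
  where
  split₀ : ∀ a b c d → a + b + c + d ≡ a + (b + c + d)
  split₀ = solve-∀
sum4-split 1F (a ∷ b ∷ c ∷ d ∷ []) = split₁ a b c d
  where
  split₁ : ∀ a b c d → a + b + c + d ≡ b + (a + c + d)
  split₁ = solve-∀
sum4-split 2F (a ∷ b ∷ c ∷ d ∷ []) = split₂ a b c d
  where
  split₂ : ∀ a b c d → a + b + c + d ≡ c + (a + b + d)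
  split₂ = solve-∀
sum4-split 3F (a ∷ b ∷ c ∷ d ∷ []) = split₃ a b c d
  where
  split₃ : ∀ a b c d → a + b + c + d ≡ d + (a + b + c)
  split₃ = solve-∀

Exceeds : Fin 4 → Quad → Set
Exceeds i v = othersSum i v < lookup v i

NoneExceeds : Quad → Set
NoneExceeds v = ∀ i → ¬ Exceeds i v

Selected : Gen → Quad → Set
Selected (S i)  v = Exceeds i v
Selected (S⊥ j) v = NoneExceeds v × lookup v j < + 0

Balanced : Quad → Set
Balanced v = NoneExceeds v × (∀ i → + 0 ≤ lookup v i)

ChoiceSpec : Quad → Maybe Gen → Set
ChoiceSpec v (just g) = Selected g v
ChoiceSpec v nothing  = Balanced v

noneExceeds : ∀ {a b c d} → ¬ (b + c + d < a) → ¬ (a + c + d < b) → ¬ (a + b + d < c) →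
              ¬ (a + b + c < d) → NoneExceeds (a ∷ b ∷ c ∷ d ∷ [])
noneExceeds ¬p₀ _ _ _ 0F = ¬p₀
noneExceeds _ ¬p₁ _ _ 1F = ¬p₁
noneExceeds _ _ ¬p₂ _ 2F = ¬p₂
noneExceeds _ _ _ ¬p₃ 3F = ¬p₃

chooseGen-spec : ∀ v → ChoiceSpec v (chooseGen v)
chooseGen-spec (a ∷ b ∷ c ∷ d ∷ []) with b + c + d <? a
... | yes p = p
... | no ¬p₀ with a + c + d <? b
... | yes p = p
... | no ¬p₁ with a + b + d <? c
... | yes p = p
... | no ¬p₂ with a + b + c <? d
... | yes p = p
... | no ¬p₃ with a <? + 0
... | yes n = noneExceeds ¬p₀ ¬p₁ ¬p₂ ¬p₃ , n
... | no ¬n₀ with b <? + 0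
... | yes n = noneExceeds ¬p₀ ¬p₁ ¬p₂ ¬p₃ , n
... | no ¬n₁ with c <? + 0
... | yes n = noneExceeds ¬p₀ ¬p₁ ¬p₂ ¬p₃ , n
... | no ¬n₂ with d <? + 0
... | yes n = noneExceeds ¬p₀ ¬p₁ ¬p₂ ¬p₃ , n
... | no ¬n₃ = noneExceeds ¬p₀ ¬p₁ ¬p₂ ¬p₃ , λ where
    0F → ≮⇒≥ ¬n₀
    1F → ≮⇒≥ ¬n₁
    2F → ≮⇒≥ ¬n₂
    3F → ≮⇒≥ ¬n₃

chooseGen-selected : ∀ v {g} → chooseGen v ≡ just g → Selected g v
chooseGen-selected v eq = subst (ChoiceSpec v) eq (chooseGen-spec v)

chooseGen-balanced : ∀ v → chooseGen v ≡ nothing → Balanced v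
chooseGen-balanced v eq = subst (ChoiceSpec v) eq (chooseGen-spec v)

-- Descent of the curvature sum

descentMargin : ℤ → ℤ → ℤ
descentMargin x t = t * t + + 6 * x * t - + 3 * x * x

nonneg-modulo-form : ∀ {z f} e₁ e₂ e₃ → f ≡ + 0 →
                     z ≡ + 2 * (e₁ * e₁ + e₂ * e₂ + e₃ * e₃) + + 3 * f → + 0 ≤ z
nonneg-modulo-form e₁ e₂ e₃ refl eq = subst (+ 0 ≤_) (sym eq)
  (+-mono-≤ (*-nonneg {+ 2} (+≤+ z≤n)
    (+-mono-≤ (+-mono-≤ (square-nonneg e₁) (square-nonneg e₂)) (square-nonneg e₃))) (+≤+ z≤n))

descentMargin-nonneg : ∀ i v → IsDescartes v → + 0 ≤ descentMargin (lookup v i) (othersSum i v)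
descentMargin-nonneg 0F (a ∷ b ∷ c ∷ d ∷ []) D = nonneg-modulo-form (b - c) (b - d) (c - d) D (disc₀ a b c d)
  where
  disc₀ : ∀ a b c d → let t = b + c + d; s = a + b + c + d in
    t * t + + 6 * a * t - + 3 * a * a ≡
    + 2 * ((b - c) * (b - c) + (b - d) * (b - d) + (c - d) * (c - d)) +
    + 3 * (s * s - + 2 * (a * a + b * b + c * c + d * d))
  disc₀ = solve-∀
descentMargin-nonneg 1F (a ∷ b ∷ c ∷ d ∷ []) D = nonneg-modulo-form (a - c) (a - d) (c - d) D (disc₁ a b c d)
  where
  disc₁ : ∀ a b c d → let t = a + c + d; s = a + b + c + d in
    t * t + + 6 * b * t - + 3 * b * b ≡
    + 2 * ((a - c) * (a - c) + (a - d) * (a - d) + (c - d) * (c - d)) +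
    + 3 * (s * s - + 2 * (a * a + b * b + c * c + d * d))
  disc₁ = solve-∀
descentMargin-nonneg 2F (a ∷ b ∷ c ∷ d ∷ []) D = nonneg-modulo-form (a - b) (a - d) (b - d) D (disc₂ a b c d)
  where
  disc₂ : ∀ a b c d → let t = a + b + d; s = a + b + c + d in
    t * t + + 6 * c * t - + 3 * c * c ≡
    + 2 * ((a - b) * (a - b) + (a - d) * (a - d) + (b - d) * (b - d)) +
    + 3 * (s * s - + 2 * (a * a + b * b + c * c + d * d))
  disc₂ = solve-∀
descentMargin-nonneg 3F (a ∷ b ∷ c ∷ d ∷ []) D = nonneg-modulo-form (a - b) (a - c) (b - c) D (disc₃ a b c d)
  where
  disc₃ : ∀ a b c d → let t = a + b + c; s = a + b + c + d in
    t * t + + 6 * d * t - + 3 * d * d ≡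
    + 2 * ((a - b) * (a - b) + (a - c) * (a - c) + (b - c) * (b - c)) +
    + 3 * (s * s - + 2 * (a * a + b * b + c * c + d * d))
  disc₃ = solve-∀

sum-reflection : ∀ i v → sum4 (mat (S i) · v) ≡ + 3 * othersSum i v - lookup v i
sum-reflection i v = trans (sum4-· (mat (S i)) v) (columnSums i v)
  where
  cols₀ : ∀ a b c d → - + 1 * a + + 3 * b + + 3 * c + + 3 * d ≡ + 3 * (b + c + d) - a
  cols₀ = solve-∀
  cols₁ : ∀ a b c d → + 3 * a + - + 1 * b + + 3 * c + + 3 * d ≡ + 3 * (a + c + d) - b
  cols₁ = solve-∀
  cols₂ : ∀ a b c d → + 3 * a + + 3 * b + - + 1 * c + + 3 * d ≡ + 3 * (a + b + d) - c
  cols₂ = solve-∀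
  cols₃ : ∀ a b c d → + 3 * a + + 3 * b + + 3 * c + - + 1 * d ≡ + 3 * (a + b + c) - d
  cols₃ = solve-∀
  columnSums : ∀ i v → dot (transpose (mat (S i)) · ones) v ≡ + 3 * othersSum i v - lookup v i
  columnSums 0F (a ∷ b ∷ c ∷ d ∷ []) = cols₀ a b c d
  columnSums 1F (a ∷ b ∷ c ∷ d ∷ []) = cols₁ a b c d
  columnSums 2F (a ∷ b ∷ c ∷ d ∷ []) = cols₂ a b c d
  columnSums 3F (a ∷ b ∷ c ∷ d ∷ []) = cols₃ a b c d

sum-inversion : ∀ j v → sum4 (mat (S⊥ j) · v) ≡ + 5 * lookup v j + othersSum j v
sum-inversion j v = trans (sum4-· (mat (S⊥ j)) v) (columnSums j v)
  where
  cols₀ : ∀ a b c d → + 5 * a + + 1 * b + + 1 * c + + 1 * d ≡ + 5 * a + (b + c + d)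
  cols₀ = solve-∀
  cols₁ : ∀ a b c d → + 1 * a + + 5 * b + + 1 * c + + 1 * d ≡ + 5 * b + (a + c + d)
  cols₁ = solve-∀
  cols₂ : ∀ a b c d → + 1 * a + + 1 * b + + 5 * c + + 1 * d ≡ + 5 * c + (a + b + d)
  cols₂ = solve-∀
  cols₃ : ∀ a b c d → + 1 * a + + 1 * b + + 1 * c + + 5 * d ≡ + 5 * d + (a + b + c)
  cols₃ = solve-∀
  columnSums : ∀ j v → dot (transpose (mat (S⊥ j)) · ones) v ≡ + 5 * lookup v j + othersSum j v
  columnSums 0F (a ∷ b ∷ c ∷ d ∷ []) = cols₀ a b c d
  columnSums 1F (a ∷ b ∷ c ∷ d ∷ []) = cols₁ a b c d
  columnSums 2F (a ∷ b ∷ c ∷ d ∷ []) = cols₂ a b c d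
  columnSums 3F (a ∷ b ∷ c ∷ d ∷ []) = cols₃ a b c d

reflection-decreases : ∀ {x t} → t < x → + 3 * t - x < x + t
reflection-decreases {x} {t} t<x = <-by-gap 1 t<x (gap x t)
  where
  gap : ∀ x t → x + t - (+ 3 * t - x) ≡ + 2 * (x - t)
  gap = solve-∀

inversion-decreases : ∀ {x t} → x < + 0 → + 5 * x + t < x + t
inversion-decreases {x} {t} x<0 = <-by-gap 3 x<0 (gap x t)
  where
  gap : ∀ x t → x + t - (+ 5 * x + t) ≡ + 4 * (+ 0 - x)
  gap = solve-∀

reflection-positive : ∀ {x t} → + 0 ≤ descentMargin x t → + 0 < x + t → + 0 < + 3 * t - x
reflection-positive {x} {t} disc pos =
  positive-of-bound pos (≤-by-gap (*-nonneg {+ 2} (+≤+ z≤n) disc) (bound x t))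
  where
  bound : ∀ x t → + 4 * ((x + t) * (+ 3 * t - x)) - ((x + t) * (x + t) + (+ 3 * t - x) * (+ 3 * t - x))
                  ≡ + 2 * (t * t + + 6 * x * t - + 3 * x * x)
  bound = solve-∀

inversion-positive : ∀ {x t} → + 0 ≤ descentMargin x t → + 0 < x + t → + 0 < + 5 * x + t
inversion-positive {x} {t} disc pos =
  positive-of-bound pos (≤-by-gap (*-nonneg {+ 2} (+≤+ z≤n) disc) (bound x t))
  where
  bound : ∀ x t → + 4 * ((x + t) * (+ 5 * x + t)) - ((x + t) * (x + t) + (+ 5 * x + t) * (+ 5 * x + t))
                  ≡ + 2 * (t * t + + 6 * x * t - + 3 * x * x)
  bound = solve-∀

sum-decreases : ∀ g v → Selected g v → sum4 (mat g · v) < sum4 v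
sum-decreases (S i) v exceeds =
  subst₂ _<_ (sym (sum-reflection i v)) (sym (sum4-split i v)) (reflection-decreases {lookup v i} {othersSum i v} exceeds)
sum-decreases (S⊥ j) v (_ , negative) =
  subst₂ _<_ (sym (sum-inversion j v)) (sym (sum4-split j v)) (inversion-decreases {lookup v j} {othersSum j v} negative)

sum-positive-image : ∀ g {v} → IsDescartes v → + 0 < sum4 v → + 0 < sum4 (mat g · v)
sum-positive-image (S i) {v} D pos = subst (+ 0 <_) (sym (sum-reflection i v))
  (reflection-positive {lookup v i} {othersSum i v} (descentMargin-nonneg i v D)
                       (subst (+ 0 <_) (sum4-split i v) pos))
sum-positive-image (S⊥ j) {v} D pos = subst (+ 0 <_) (sym (sum-inversion j v))
  (inversion-positive {lookup v j} {othersSum j v} (descentMargin-nonneg j v D)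
                      (subst (+ 0 <_) (sum4-split j v) pos))

-- Consecutive choices

no-return : ∀ {g h v} → Selected g v → Selected h (mat g · v) → mat g ≡ mat h → ⊥
no-return {g} {h} {v} selected-g selected-h g≡h = <-irrefl refl (begin-strict
  sum4 v                       ≡⟨ cong sum4 (·-involutive g v) ⟨
  sum4 (mat g · (mat g · v))   ≡⟨ cong (λ M → sum4 (M · (mat g · v))) g≡h ⟩
  sum4 (mat h · (mat g · v))   <⟨ sum-decreases h (mat g · v) selected-h ⟩
  sum4 (mat g · v)             <⟨ sum-decreases g v selected-g ⟩
  sum4 v                       ∎)
  where open ≤-Reasoning

excessRow : Fin 4 → Quad
excessRow 0F = + 1 ∷ - + 1 ∷ - + 1 ∷ - + 1 ∷ []
excessRow 1F = - + 1 ∷ + 1 ∷ - + 1 ∷ - + 1 ∷ []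
excessRow 2F = - + 1 ∷ - + 1 ∷ + 1 ∷ - + 1 ∷ []
excessRow 3F = - + 1 ∷ - + 1 ∷ - + 1 ∷ + 1 ∷ []

excess-dot : ∀ i v → lookup v i - othersSum i v ≡ dot (excessRow i) v
excess-dot 0F (a ∷ b ∷ c ∷ d ∷ []) = excess₀ a b c d
  where
  excess₀ : ∀ a b c d → a - (b + c + d) ≡ + 1 * a + - + 1 * b + - + 1 * c + - + 1 * d
  excess₀ = solve-∀
excess-dot 1F (a ∷ b ∷ c ∷ d ∷ []) = excess₁ a b c d
  where
  excess₁ : ∀ a b c d → b - (a + c + d) ≡ - + 1 * a + + 1 * b + - + 1 * c + - + 1 * d
  excess₁ = solve-∀
excess-dot 2F (a ∷ b ∷ c ∷ d ∷ []) = excess₂ a b c d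
  where
  excess₂ : ∀ a b c d → c - (a + b + d) ≡ - + 1 * a + - + 1 * b + + 1 * c + - + 1 * d
  excess₂ = solve-∀
excess-dot 3F (a ∷ b ∷ c ∷ d ∷ []) = excess₃ a b c d
  where
  excess₃ : ∀ a b c d → d - (a + b + c) ≡ - + 1 * a + - + 1 * b + - + 1 * c + + 1 * d
  excess₃ = solve-∀

exceeds-after-S⊥ : ∀ i j → i ≢ j → ∀ v → Exceeds i (mat (S⊥ j) · v) → Exceeds i v
exceeds-after-S⊥ i j i≢j v exceeds =
  0<-difference⇒< (subst (+ 0 <_) excess-unchanged (<⇒0<-difference exceeds))
  where
  open ≡-Reasoning
  M : Mat
  M = mat (S⊥ j)
  fixed : ∀ i j → i ≢ j → transpose (mat (S⊥ j)) · excessRow i ≡ excessRow i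
  fixed 0F 0F i≢j = ⊥-elim (i≢j refl)
  fixed 1F 1F i≢j = ⊥-elim (i≢j refl)
  fixed 2F 2F i≢j = ⊥-elim (i≢j refl)
  fixed 3F 3F i≢j = ⊥-elim (i≢j refl)
  fixed 0F 1F _ = refl
  fixed 0F 2F _ = refl
  fixed 0F 3F _ = refl
  fixed 1F 0F _ = refl
  fixed 1F 2F _ = refl
  fixed 1F 3F _ = refl
  fixed 2F 0F _ = refl
  fixed 2F 1F _ = refl
  fixed 2F 3F _ = refl
  fixed 3F 0F _ = refl
  fixed 3F 1F _ = refl
  fixed 3F 2F _ = refl
  excess-unchanged : lookup (M · v) i - othersSum i (M · v) ≡ lookup v i - othersSum i v
  excess-unchanged = begin
    lookup (M · v) i - othersSum i (M · v)  ≡⟨ excess-dot i (M · v) ⟩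
    dot (excessRow i) (M · v)               ≡⟨ dot-· (excessRow i) M v ⟩
    dot (transpose M · excessRow i) v       ≡⟨ cong (λ r → dot r v) (fixed i j i≢j) ⟩
    dot (excessRow i) v                     ≡⟨ excess-dot i v ⟨
    lookup v i - othersSum i v              ∎

consecutive-allowed : ∀ {g h v} → Selected g v → Selected h (mat g · v) → ¬ BadPair g h
consecutive-allowed selected-g selected-h (sameMat g≡h) = no-return selected-g selected-h g≡h
consecutive-allowed {v = v} (none , _) exceeds (perpThenS {i} {j} i≢j) =
  none i (exceeds-after-S⊥ i j i≢j v exceeds)

run-invertNormalForm : ∀ {v ws w} → TIRun v ws w → InvertNormalForm ws
run-invertNormalForm (stop _)                       = []
run-invertNormalForm (step _ _ (stop _))            = [-]
run-invertNormalForm (step _ eq run@(step _ eq′ _)) =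
  consecutive-allowed (chooseGen-selected _ eq) (chooseGen-selected _ eq′) ∷ run-invertNormalForm run

run-word : ∀ {v ws w} → TIRun v ws w → v ≡ applyWord ws w
run-word (stop _) = refl
run-word {v} {g ∷ ws} {w} (step _ _ run) = begin
  v                       ≡⟨ ·-involutive g v ⟨
  mat g · (mat g · v)     ≡⟨ cong (mat g ·_) (run-word run) ⟩
  mat g · applyWord ws w  ∎
  where open ≡-Reasoning

-- Balanced Descartes quadruples

zero-or-half : ∀ {v} → IsDescartes v → Balanced v →
               ∀ i → lookup v i ≡ + 0 ⊎ lookup v i + lookup v i ≡ sum4 v
zero-or-half {v@(a ∷ b ∷ c ∷ d ∷ [])} D (none , nonneg) i =
  map₂ half (i*j≡0⇒i≡0∨j≡0 (lookup v i) (term-zero i))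
  where
  term : Fin 4 → ℤ
  term i = lookup v i * (othersSum i v - lookup v i)
  terms-sum : ∀ a b c d →
    a * (b + c + d - a) + b * (a + c + d - b) + c * (a + b + d - c) + d * (a + b + c - d) ≡
    (a + b + c + d) * (a + b + c + d) - + 2 * (a * a + b * b + c * c + d * d)
  terms-sum = solve-∀
  term-zero : ∀ i → term i ≡ + 0
  term-zero = nonneg-sum4-zero term (λ i → *-nonneg (nonneg i) (i≤j⇒0≤j-i (≮⇒≥ (none i))))
                                    (trans (terms-sum a b c d) D)
  half : othersSum i v - lookup v i ≡ + 0 → lookup v i + lookup v i ≡ sum4 v
  half balance = trans (cong (λ t → lookup v i + t) (sym (i-j≡0⇒i≡j _ _ balance))) (sym (sum4-split i v))

halving-entry : ∀ {v} → + 0 < sum4 v →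
  (∀ i → lookup v i ≡ + 0 ⊎ lookup v i + lookup v i ≡ sum4 v) → ∃ λ h → h + h ≡ sum4 v
halving-entry {a ∷ b ∷ c ∷ d ∷ []} pos entry with entry 0F | entry 1F | entry 2F | entry 3F
... | inj₂ a+a≡s | _          | _          | _          = a , a+a≡s
... | inj₁ _     | inj₂ b+b≡s | _          | _          = b , b+b≡s
... | inj₁ _     | inj₁ _     | inj₂ c+c≡s | _          = c , c+c≡s
... | inj₁ _     | inj₁ _     | inj₁ _     | inj₂ d+d≡s = d , d+d≡s
... | inj₁ refl  | inj₁ refl  | inj₁ refl  | inj₁ refl with pos
...   | +<+ ()

∣-zero-or-self : ∀ {e h} → e ≡ + 0 ⊎ e ≡ h → h ∣ e
∣-zero-or-self (inj₁ refl) = divides (+ 0) refl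
∣-zero-or-self (inj₂ refl) = ∣-refl

binary-simplest : ∀ {v} → (∀ i → lookup v i ≡ + 0 ⊎ lookup v i ≡ + 1) → sum4 v ≡ + 2 → Simplest v
binary-simplest {a ∷ b ∷ c ∷ d ∷ []} bit sum≡2 with bit 0F | bit 1F | bit 2F | bit 3F | sum≡2
... | inj₁ refl | inj₁ refl | inj₁ refl | inj₁ refl | ()
... | inj₁ refl | inj₁ refl | inj₁ refl | inj₂ refl | ()
... | inj₁ refl | inj₁ refl | inj₂ refl | inj₁ refl | ()
... | inj₁ refl | inj₁ refl | inj₂ refl | inj₂ refl | _ = there (there (there (there (there (here refl)))))
... | inj₁ refl | inj₂ refl | inj₁ refl | inj₁ refl | ()
... | inj₁ refl | inj₂ refl | inj₁ refl | inj₂ refl | _ = there (there (there (there (here refl))))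
... | inj₁ refl | inj₂ refl | inj₂ refl | inj₁ refl | _ = there (there (there (here refl)))
... | inj₁ refl | inj₂ refl | inj₂ refl | inj₂ refl | ()
... | inj₂ refl | inj₁ refl | inj₁ refl | inj₁ refl | ()
... | inj₂ refl | inj₁ refl | inj₁ refl | inj₂ refl | _ = there (there (here refl))
... | inj₂ refl | inj₁ refl | inj₂ refl | inj₁ refl | _ = there (here refl)
... | inj₂ refl | inj₁ refl | inj₂ refl | inj₂ refl | ()
... | inj₂ refl | inj₂ refl | inj₁ refl | inj₁ refl | _ = here refl
... | inj₂ refl | inj₂ refl | inj₁ refl | inj₂ refl | ()
... | inj₂ refl | inj₂ refl | inj₂ refl | inj₁ refl | ()
... | inj₂ refl | inj₂ refl | inj₂ refl | inj₂ refl | ()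

balanced-simplest : ∀ {v} → IsDescartes v → EntriesCoprime v → + 0 < sum4 v → Balanced v → Simplest v
balanced-simplest {v} D coprime pos balanced with halving-entry {v} pos (zero-or-half D balanced)
... | h , h+h≡s = binary-simplest (λ i → map₂ (λ e → trans e h≡1) (value i))
                                  (trans (sym h+h≡s) (cong (λ x → x + x) h≡1))
  where
  value : ∀ i → lookup v i ≡ + 0 ⊎ lookup v i ≡ h
  value i = map₂ (λ e → double-injective (trans e (sym h+h≡s))) (zero-or-half {v} D balanced i)
  h≡1 : h ≡ + 1
  h≡1 = unit-of-positive-double (coprime h (∣-zero-or-self ∘ value)) (subst (+ 0 <_) (sym h+h≡s) pos)

Reaches : Quad → Set
Reaches v = Σ (List Gen) λ ws → Σ Quad λ w → TIRun v ws w × Simplest w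

extend : ∀ {v g} → ¬ Simplest v → chooseGen v ≡ just g → Reaches (mat g · v) → Reaches v
extend {g = g} ¬s choice (ws , w , run , s) = g ∷ ws , w , step ¬s choice run , s

reaches-simplest : ∀ v → IsDescartes v → EntriesCoprime v → + 0 < sum4 v → Reaches v
reaches-simplest v D coprime pos = go v D coprime pos (<-wellFounded ∣ sum4 v ∣)
  where
  go : ∀ v → IsDescartes v → EntriesCoprime v → + 0 < sum4 v → Acc ℕ._<_ ∣ sum4 v ∣ → Reaches v
  go v D coprime pos (acc smaller) with v ∈? simplestList | chooseGen v in choice
  ... | yes s | _       = [] , v , stop s , s
  ... | no ¬s | nothing = ⊥-elim (¬s (balanced-simplest D coprime pos (chooseGen-balanced v choice)))
  ... | no ¬s | just g  =
    extend ¬s choice (go (mat g · v) (isDescartes-mat g D) (entriesCoprime-mat g coprime) pos′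
                         (smaller decrease))
    where
    pos′ : + 0 < sum4 (mat g · v)
    pos′ = sum-positive-image g D pos
    decrease : ∣ sum4 (mat g · v) ∣ ℕ.< ∣ sum4 v ∣
    decrease = ∣∣-mono-< (<⇒≤ pos′) (sum-decreases g v (chooseGen-selected v choice))

simplest-permutation : ∀ {w} → Simplest w → Σ (Permutation′ 4) λ σ → w ≡ permute σ base
simplest-permutation (here refl)                                 = idₚ , refl
simplest-permutation (there (here refl))                         = swap 1F 2F , refl
simplest-permutation (there (there (here refl)))                 = swap 1F 3F , refl
simplest-permutation (there (there (there (here refl))))         = swap 0F 2F , refl
simplest-permutation (there (there (there (there (here refl))))) = swap 0F 3F , refl
simplest-permutation (there (there (there (there (there (here refl)))))) =
  swap 0F 2F ∘ₚ swap 1F 3F , refl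


mainTheorem8 : (v : Quad) → IsDescartes v → IsPrimitive v → + 0 < sum4 v →
    Σ (List Gen) λ ws → Σ Quad λ w →
      TIRun v ws w × Simplest w × InvertNormalForm ws ×
      Σ (Permutation′ 4) λ σ → v ≡ applyWord ws (permute σ base)
mainTheorem8 v D prim pos with reaches-simplest v D (isPrimitive⇒entriesCoprime prim) pos
... | ws , w , run , s with simplest-permutation s
... | σ , w≡σbase =
  ws , w , run , s , run-invertNormalForm run , σ , trans (run-word run) (cong (applyWord ws) w≡σbase)
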